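{- Let $\mathcal{L}\in\{\mathrm{PL},\mathrm{PL}(\underline{\vee}),\mathrm{PD}\}$ and $\varphi$ an $\mathcal{L}$-formula. If some saturated tableau for $\varphi$ in $\mathbf{T}_{\mathcal{L}}$ has an open branch, then $\varphi$ is not valid.
   Context: Syntax (negation normal form): $\mathrm{PL}$: $\varphi::=p\mid\neg p\mid(\varphi\wedge\varphi)\mid(\varphi\vee\varphi)$; $\mathrm{PL}(\underline{\vee})$ adds $(\varphi\,\underline{\vee}\,\varphi)$; $\mathrm{PD}$ adds atoms ${=}(p_1,\dots,p_n,q)$. $p^\top:=p$, $p^\bot:=\neg p$. Team semantics: a team $X$ is a set of assignments $s:D\to\{0,1\}$ ($D$ a finite set of proposition symbols containing those of the formula). $X\models p$ iff $s(p)=1$ for all $s\in X$; $X\models\neg p$ iff $s(p)=0$ for all $s\in X$; $\wedge$ conjunctively; $X\models\varphi\vee\psi$ iff $X=Y\cup Z$ with $Y\models\varphi$, $Z\models\psi$; $X\models\varphi\,\underline{\vee}\,\psi$ iff $X\models\varphi$ or $X\models\psi$; $X\models{=}(p_1,\dots,p_n,q)$ iff any $s,t\in X$ agreeing on all $p_i$ agree on $q$. Valid: true in every team. $\mathrm{vrank}(\varphi)$: number of $\underline{\vee}$ in $\varphi$, where each ${=}(p_1,\dots,p_n,q)$ is counted via its replacement $\bigvee_{\vec a\in\{\bot,\top\}^n}\bigwedge\{p_1^{a_1},\dots,p_n^{a_n},(q\,\underline{\vee}\,\neg q)\}$. Labeled tableaux: labels are finite subsets of $\mathbb{N}$; labeled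 formulas $\alpha:\varphi$. A tableau is a finitely branching tree of labeled formulas built from the root by rule applications; each rule extends a branch containing its premise by alternatives (separated by $\mid$), each alternative adding all listed labeled formulas; a labeled formula is never added to a branch already containing it. Rules: (Prop) from $\{i_1,\dots,i_k\}:p$: $\{i_1\}:p\mid\dots\mid\{i_k\}:p$; ($\neg$Prop) likewise for $\neg p$; ($\wedge$) from $\alpha:(\varphi\wedge\psi)$: $\alpha:\varphi\mid\alpha:\psi$; ($\vee$) from $\alpha:(\varphi\vee\psi)$ and any $\beta\subseteq\alpha$: $\beta:\varphi\mid\alpha\setminus\beta:\psi$; ($\underline{\vee}$) from $\alpha:(\varphi\,\underline{\vee}\,\psi)$: add $\alpha:\varphi$ and $\alpha:\psi$; (Split) from $\alpha:{=}(\vec p,q)$: $\alpha_1:{=}(\vec p,q)\mid\dots\mid\alpha_k:{=}(\vec p,q)$ with $\alpha_1,\dots,\alpha_k$ all 2-element subsets of $\alpha$; (PL dep) from $\{i_1,i_2\}:{=}(p_1,\dots,p_n,q)$: one alternative per $g:\{1,\dots,n\}\to\{\top,\bot\}$ adding $\{i_1\}:p_m^{g(m)},\{i_2\}:p_m^{g(m)}$ ($m\le n$), $\{i_1,i_2\}:q$, $\{i_1,i_2\}:\neg q$. $\mathbf{T}_{\mathrm{PL}}$ = (Prop), ($\neg$Prop), ($\wedge$), ($\vee$); $\mathbf{T}_{\mathrm{PL}(\underline{\vee})}$ adds ($\underline{\vee}$); $\mathbf{T}_{\mathrm{PD}}$ adds (Split), (PL dep) to $\mathbf{T}_{\mathrm{PL}}$.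 A tableau for $\varphi$ in $\mathbf{T}_{\mathcal{L}}$ has root $\{1,\dots,2^{\mathrm{vrank}(\varphi)}\}:\varphi$ and uses rules of $\mathbf{T}_{\mathcal{L}}$. A tableau is saturated if no rule can be applied or rule applications have no effect. A branch is closed if it contains (1) both $\alpha:p$ and $\alpha:\neg p$, or (2) $\emptyset:\psi$ for some $\psi$, or (3) $\{i\}:{=}(p_1,\dots,p_n,q)$ for some $i$; otherwise it is open. -}

module Defs where

open import Data.Nat using (ℕ; zero; suc; _+_; _^_)
import Data.Nat as ℕ
open import Data.Bool using (Bool; true; false)
import Data.Bool as B
open import Data.Fin using (Fin) renaming (zero to fzero; suc to fsuc)
open import Data.Fin.Subset using (Subset; ⁅_⁆; _∪_; _─_; _⊆_; ⊤; ⊥)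
open import Data.Vec using ([]; _∷_)
import Data.Vec.Properties as VecP
open import Data.List using (List; []; _∷_; _++_; map; concat; length; filter; deduplicate; zipWith)
import Data.List.Properties as ListP
open import Data.List.Relation.Unary.All using (All)
import Data.List.Relation.Unary.All as All
open import Data.List.Relation.Unary.Any using (Any)
open import Data.List.Membership.Propositional using (_∈_)
open import Data.List.Membership.DecPropositional as DecMem using ()
open import Data.Product using (_×_; _,_; ∃; ∃-syntax; Σ-syntax)
import Data.Product.Properties as ProdP
open import Data.Sum using (_⊎_)
open import Relation.Binary.PropositionalEquality using (_≡_; _≢_; refl; cong; cong₂)
open import Relation.Binary.Definitions using (DecidableEquality)
open import Relation.Nullary using (¬_; ¬?; yes; no; Dec)
open import Relation.Nullary.Decidable using (map′; _×-dec_)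
open import Function.Bundles using (_⇔_)

data Form : Set where
  atom : ℕ → Form
  neg  : ℕ → Form
  _∧'_ : Form → Form → Form
  _∨'_ : Form → Form → Form       -- (split / tensor) disjunction
  _⊻_  : Form → Form → Form       -- intuitionistic disjunction (underlined ∨)
  dep  : List ℕ → ℕ → Form        -- =(p₁,…,pₙ,q) : dep (p₁ ∷ … ∷ pₙ ∷ []) q

data Lang : Set where
  PL PLv PD : Lang

data InL : Lang → Form → Set where
  atom : ∀ {L p} → InL L (atom p)
  neg  : ∀ {L p} → InL L (neg p)
  and  : ∀ {L φ ψ} → InL L φ → InL L ψ → InL L (φ ∧' ψ)
  or   : ∀ {L φ ψ} → InL L φ → InL L ψ → InL L (φ ∨' ψ)
  vor  : ∀ {φ ψ} → InL PLv φ → InL PLv ψ → InL PLv (φ ⊻ ψ)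
  dep  : ∀ {ps q} → InL PD (dep ps q)

lit : ℕ → Bool → Form
lit p true  = atom p
lit p false = neg p

-- Team semantics.  An assignment gives a truth value to every symbol;
-- a team is a finite set of assignments, represented by a list (only the
-- set of its elements matters).

Assignment : Set
Assignment = ℕ → Bool

Team : Set
Team = List Assignment

IsUnion : Team → Team → Team → Set
IsUnion X Y Z = ∀ s → s ∈ X ⇔ (s ∈ Y ⊎ s ∈ Z)

infix 4 _⊨_
_⊨_ : Team → Form → Set
X ⊨ atom p  = All (λ s → s p ≡ true) X
X ⊨ neg p   = All (λ s → s p ≡ false) X
X ⊨ φ ∧' ψ  = X ⊨ φ × X ⊨ ψ
X ⊨ φ ∨' ψ  = ∃[ Y ] ∃[ Z ] (IsUnion X Y Z × Y ⊨ φ × Z ⊨ ψ)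
X ⊨ φ ⊻ ψ   = X ⊨ φ ⊎ X ⊨ ψ
X ⊨ dep ps q = ∀ s t → s ∈ X → t ∈ X → All (λ p → s p ≡ t p) ps → s q ≡ t q

Valid : Form → Set
Valid φ = ∀ (X : Team) → X ⊨ φ

-- vrank: number of ⊻, where =(p₁,…,pₙ,q) counts as 2ⁿ (its replacement
-- ⋁_{a∈{⊥,⊤}ⁿ} ⋀{p₁^{a₁},…,pₙ^{aₙ},(q ⊻ ¬q)} contains 2ⁿ copies of ⊻).

vrank : Form → ℕ
vrank (atom _)   = 0
vrank (neg _)    = 0
vrank (φ ∧' ψ)   = vrank φ + vrank ψ
vrank (φ ∨' ψ)   = vrank φ + vrank ψ
vrank (φ ⊻ ψ)    = suc (vrank φ + vrank ψ)
vrank (dep ps q) = 2 ^ length ps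

Form-≟ : DecidableEquality Form
Form-≟ (atom p) (atom q) with p ℕ.≟ q
... | yes refl = yes refl
... | no ne = no λ { refl → ne refl }
Form-≟ (neg p) (neg q) with p ℕ.≟ q
... | yes refl = yes refl
... | no ne = no λ { refl → ne refl }
Form-≟ (φ ∧' ψ) (φ' ∧' ψ') with Form-≟ φ φ' | Form-≟ ψ ψ'
... | yes refl | yes refl = yes refl
... | no ne | _ = no λ { refl → ne refl }
... | _ | no ne = no λ { refl → ne refl }
Form-≟ (φ ∨' ψ) (φ' ∨' ψ') with Form-≟ φ φ' | Form-≟ ψ ψ'
... | yes refl | yes refl = yes refl
... | no ne | _ = no λ { refl → ne refl }
... | _ | no ne = no λ { refl → ne refl }
Form-≟ (φ ⊻ ψ) (φ' ⊻ ψ') with Form-≟ φ φ' | Form-≟ ψ ψ'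
... | yes refl | yes refl = yes refl
... | no ne | _ = no λ { refl → ne refl }
... | _ | no ne = no λ { refl → ne refl }
Form-≟ (dep ps q) (dep ps' q') with ListP.≡-dec ℕ._≟_ ps ps' | q ℕ.≟ q'
... | yes refl | yes refl = yes refl
... | no ne | _ = no λ { refl → ne refl }
... | _ | no ne = no λ { refl → ne refl }
Form-≟ (atom _) (neg _) = no λ ()
Form-≟ (atom _) (_ ∧' _) = no λ ()
Form-≟ (atom _) (_ ∨' _) = no λ ()
Form-≟ (atom _) (_ ⊻ _) = no λ ()
Form-≟ (atom _) (dep _ _) = no λ ()
Form-≟ (neg _) (atom _) = no λ ()
Form-≟ (neg _) (_ ∧' _) = no λ ()
Form-≟ (neg _) (_ ∨' _) = no λ ()
Form-≟ (neg _) (_ ⊻ _) = no λ ()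
Form-≟ (neg _) (dep _ _) = no λ ()
Form-≟ (_ ∧' _) (atom _) = no λ ()
Form-≟ (_ ∧' _) (neg _) = no λ ()
Form-≟ (_ ∧' _) (_ ∨' _) = no λ ()
Form-≟ (_ ∧' _) (_ ⊻ _) = no λ ()
Form-≟ (_ ∧' _) (dep _ _) = no λ ()
Form-≟ (_ ∨' _) (atom _) = no λ ()
Form-≟ (_ ∨' _) (neg _) = no λ ()
Form-≟ (_ ∨' _) (_ ∧' _) = no λ ()
Form-≟ (_ ∨' _) (_ ⊻ _) = no λ ()
Form-≟ (_ ∨' _) (dep _ _) = no λ ()
Form-≟ (_ ⊻ _) (atom _) = no λ ()
Form-≟ (_ ⊻ _) (neg _) = no λ ()
Form-≟ (_ ⊻ _) (_ ∧' _) = no λ ()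
Form-≟ (_ ⊻ _) (_ ∨' _) = no λ ()
Form-≟ (_ ⊻ _) (dep _ _) = no λ ()
Form-≟ (dep _ _) (atom _) = no λ ()
Form-≟ (dep _ _) (neg _) = no λ ()
Form-≟ (dep _ _) (_ ∧' _) = no λ ()
Form-≟ (dep _ _) (_ ∨' _) = no λ ()
Form-≟ (dep _ _) (_ ⊻ _) = no λ ()

-- All labels occurring in a tableau for φ are subsets
-- of the root label {1,…,N}, N = 2^vrank φ; we represent them as subsets
-- of Fin N (element i : Fin N stands for the index i+1).

LForm : ℕ → Set
LForm N = Subset N × Form

LForm-≟ : ∀ {N} → DecidableEquality (LForm N)
LForm-≟ = ProdP.≡-dec (VecP.≡-dec B._≟_) Form-≟

elems : ∀ {n} → Subset n → List (Fin n)
elems []          = []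
elems (true ∷ α)  = fzero ∷ map fsuc (elems α)
elems (false ∷ α) = map fsuc (elems α)

pairsL : ∀ {n} → List (Fin n) → List (Subset n)
pairsL []       = []
pairsL (i ∷ is) = map (λ j → ⁅ i ⁆ ∪ ⁅ j ⁆) is ++ pairsL is

twoSubsets : ∀ {n} → Subset n → List (Subset n)
twoSubsets α = pairsL (elems α)

-- all functions g : {1,…,n} → {⊤,⊥}, as Boolean lists of length n
bools : ℕ → List (List Bool)
bools zero    = [] ∷ []
bools (suc n) = map (true ∷_) (bools n) ++ map (false ∷_) (bools n)

depAlt : ∀ {N} → Fin N → Fin N → List ℕ → ℕ → List Bool → List (LForm N)
depAlt i j ps q g =
  concat (zipWith (λ p b → (⁅ i ⁆ , lit p b) ∷ (⁅ j ⁆ , lit p b) ∷ []) ps g)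
  ++ ((⁅ i ⁆ ∪ ⁅ j ⁆ , atom q) ∷ (⁅ i ⁆ ∪ ⁅ j ⁆ , neg q) ∷ [])

-- Rule instances of 𝐓_L:  Rule L x alts  means a rule of 𝐓_L with premise x
-- has the list of alternatives alts (each alternative a list of labeled
-- formulas to be added).
data Rule {N : ℕ} : Lang → LForm N → List (List (LForm N)) → Set where
  prop  : ∀ {L} α p → Rule L (α , atom p) (map (λ i → (⁅ i ⁆ , atom p) ∷ []) (elems α))
  nprop : ∀ {L} α p → Rule L (α , neg p) (map (λ i → (⁅ i ⁆ , neg p) ∷ []) (elems α))
  and   : ∀ {L} α φ ψ → Rule L (α , φ ∧' ψ) (((α , φ) ∷ []) ∷ ((α , ψ) ∷ []) ∷ [])
  or    : ∀ {L} α φ ψ β → β ⊆ α →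
          Rule L (α , φ ∨' ψ) (((β , φ) ∷ []) ∷ ((α ─ β , ψ) ∷ []) ∷ [])
  vor   : ∀ α φ ψ → Rule PLv (α , φ ⊻ ψ) (((α , φ) ∷ (α , ψ) ∷ []) ∷ [])
  split : ∀ α ps q →
          Rule PD (α , dep ps q) (map (λ β → (β , dep ps q) ∷ []) (twoSubsets α))
  pldep : ∀ i j ps q → i ≢ j →
          Rule PD (⁅ i ⁆ ∪ ⁅ j ⁆ , dep ps q) (map (depAlt i j ps q) (bools (length ps)))

-- formulas of an alternative that actually get added to branch Γ
-- (a labeled formula is never added to a branch already containing it)
newOn : ∀ {N} → List (LForm N) → List (LForm N) → List (LForm N)
newOn Γ a = deduplicate LForm-≟ (filter (λ x → ¬? (DecMem._∈?_ LForm-≟ x Γ)) a)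

-- Tableaux in 𝐓_L below a branch prefix Γ (the labeled formulas on the path
-- from the root so far): either stop here, or apply a rule whose premise is
-- on the branch, with one subtableau for each alternative.
data Tab (L : Lang) (N : ℕ) (Γ : List (LForm N)) : Set where
  leaf : Tab L N Γ
  node : ∀ {x alts} → x ∈ Γ → Rule L x alts →
         All (λ a → Tab L N (Γ ++ newOn Γ a)) alts → Tab L N Γ

data Branch {L N} : ∀ {Γ} → Tab L N Γ → List (LForm N) → Set where
  here  : ∀ {Γ} → Branch (leaf {Γ = Γ}) Γ
  there : ∀ {Γ x alts a Δ} {m : x ∈ Γ} {r : Rule L x alts}
          {ts : All (λ a → Tab L N (Γ ++ newOn Γ a)) alts} →
          (k : a ∈ alts) → Branch (All.lookup ts k) Δ → Branch (node m r ts) Δ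

-- a branch is saturated: every rule application on it has no effect,
-- i.e. some alternative is already contained in it
SaturatedBranch : ∀ {N} → Lang → List (LForm N) → Set
SaturatedBranch L Δ =
  ∀ {x alts} → x ∈ Δ → Rule L x alts → Any (λ a → All (_∈ Δ) a) alts

Saturated : ∀ {L N Γ} → Tab L N Γ → Set
Saturated {L} t = ∀ Δ → Branch t Δ → SaturatedBranch L Δ

Closed : ∀ {N} → List (LForm N) → Set
Closed Δ =
  (∃[ α ] ∃[ p ] ((α , atom p) ∈ Δ × (α , neg p) ∈ Δ))
  ⊎ (∃[ ψ ] ((⊥ , ψ) ∈ Δ))
  ⊎ (∃[ i ] ∃[ ps ] ∃[ q ] ((⁅ i ⁆ , dep ps q) ∈ Δ))

Open : ∀ {N} → List (LForm N) → Set
Open Δ = ¬ Closed Δ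

TableauFor : Lang → (φ : Form) → Set
TableauFor L φ = Tab L (2 ^ vrank φ) ((⊤ , φ) ∷ [])

-- An open saturated branch Δ is read as a countermodel.  For each index i of
-- the root label let sᵢ be the assignment making p false exactly when {i}:p
-- lies on Δ.  By induction on ψ, whenever α:ψ is on Δ, no team containing
-- {sᵢ | i ∈ α} satisfies ψ: saturation provides, for every formula on Δ, a
-- rule alternative already on Δ, and openness rules out {i}:p next to {i}:¬p
-- and singleton dependence atoms.  For Y = Y₁ ∪ Y₂ ⊨ φ ∨ ψ the (∨) rule is
-- applied with β ⊆ α chosen so that sᵢ ∈ Y₁ for i ∈ β and sᵢ ∈ Y₂ for
-- i ∈ α ∖ β.  Hence the team of all sᵢ refutes the root φ.
module Submission where

open import Defs
open import Data.Bool using (Bool; true; false; not)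
open import Data.Bool.Properties using (not-¬)
open import Data.Empty using (⊥-elim)
open import Data.Fin using (Fin; _≟_) renaming (zero to fzero; suc to fsuc)
open import Data.Fin.Subset using (Subset; ⁅_⁆; _∪_; _─_; _⊆_; ⊤) renaming (_∈_ to _∈ₛ_)
open import Data.Fin.Subset.Properties using (x∈p∪q⁻; x∈⁅y⁆⇒x≡y; ∪-idem)
open import Data.List using (List; []; _∷_; map; concat; zipWith; length; allFin)
open import Data.List.Membership.Propositional using (_∈_; find)
open import Data.List.Membership.Propositional.Properties
  using (∈-map⁺; ∈-map⁻; ∈-++⁻; ∈-++⁺ˡ; ∈-allFin)
import Data.List.Membership.DecPropositional as DecMembership
open import Data.List.Relation.Unary.All using (All; []; _∷_)
import Data.List.Relation.Unary.All as All
open import Data.List.Relation.Unary.All.Properties using (++⁻)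
open import Data.List.Relation.Unary.Any using (Any; here; there)
import Data.List.Relation.Unary.Any.Properties as Any
open import Data.Nat using (ℕ; zero; suc)
open import Data.Nat.Properties using (suc-injective)
open import Data.Product using (_×_; _,_; ∃-syntax)
open import Data.Sum using (_⊎_; inj₁; inj₂; [_,_]′)
open import Data.Vec using ([]; _∷_; here; there)
open import Function using (_∘_)
open import Function.Bundles using (Equivalence)
open import Relation.Binary.PropositionalEquality
  using (_≡_; _≢_; refl; sym; trans; cong; subst; module ≡-Reasoning)
open import Relation.Nullary using (¬_; yes; no; does; contradiction)
open import Relation.Nullary.Decidable using (dec-true; dec-false)

∈-elems⁻ : ∀ {n} (α : Subset n) {i} → i ∈ elems α → i ∈ₛ α
∈-elems⁻ (true ∷ α) (here refl) = here
∈-elems⁻ (true ∷ α) (there m) with ∈-map⁻ fsuc m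
... | j , j∈ , refl = there (∈-elems⁻ α j∈)
∈-elems⁻ (false ∷ α) m with ∈-map⁻ fsuc m
... | j , j∈ , refl = there (∈-elems⁻ α j∈)

∈-pairsL⁻ : ∀ {n} (is : List (Fin n)) {β} → β ∈ pairsL is →
            ∃[ i ] ∃[ j ] (i ∈ is × j ∈ is × β ≡ ⁅ i ⁆ ∪ ⁅ j ⁆)
∈-pairsL⁻ (i ∷ is) m with ∈-++⁻ (map (λ j → ⁅ i ⁆ ∪ ⁅ j ⁆) is) m
... | inj₁ m′ with ∈-map⁻ (λ j → ⁅ i ⁆ ∪ ⁅ j ⁆) m′
...   | j , j∈ , eq = i , j , here refl , there j∈ , eq
∈-pairsL⁻ (i ∷ is) m | inj₂ m′ with ∈-pairsL⁻ is m′
...   | i′ , j , i′∈ , j∈ , eq = i′ , j , there i′∈ , there j∈ , eq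

∈-twoSubsets⁻ : ∀ {n} (α : Subset n) {β} → β ∈ twoSubsets α →
                ∃[ i ] ∃[ j ] (i ∈ₛ α × j ∈ₛ α × β ≡ ⁅ i ⁆ ∪ ⁅ j ⁆)
∈-twoSubsets⁻ α m with ∈-pairsL⁻ (elems α) m
... | i , j , i∈ , j∈ , eq = i , j , ∈-elems⁻ α i∈ , ∈-elems⁻ α j∈ , eq

bools-length : ∀ n {g} → g ∈ bools n → length g ≡ n
bools-length zero (here refl) = refl
bools-length (suc n) m = [ cons-length true , cons-length false ]′ (∈-++⁻ _ m)
  where
    cons-length : ∀ b {g} → g ∈ map (b ∷_) (bools n) → length g ≡ suc n
    cons-length b m′ with ∈-map⁻ (b ∷_) m′
    ... | g , g∈ , refl = cong suc (bools-length n g∈)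

constant-on-pair : ∀ {n} {A : Set} (f : Fin n → A) {i j k} →
                   f i ≡ f j → k ∈ₛ ⁅ i ⁆ ∪ ⁅ j ⁆ → f k ≡ f i
constant-on-pair f {i} {j} fi≡fj k∈ with x∈p∪q⁻ ⁅ i ⁆ ⁅ j ⁆ k∈
... | inj₁ k∈i rewrite x∈⁅y⁆⇒x≡y i k∈i = refl
... | inj₂ k∈j rewrite x∈⁅y⁆⇒x≡y j k∈j = sym fi≡fj

Covers : ∀ {n} {A : Set} → (Fin n → A) → Subset n → List A → Set
Covers f α Y = ∀ {i} → i ∈ₛ α → f i ∈ Y

cover-split : ∀ {n} {A : Set} (f : Fin n → A) (α : Subset n) {Y Y₁ Y₂ : List A} →
              (∀ {x} → x ∈ Y → x ∈ Y₁ ⊎ x ∈ Y₂) → Covers f α Y →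
              ∃[ β ] (β ⊆ α × Covers f β Y₁ × Covers f (α ─ β) Y₂)
cover-split f [] _ _ = [] , (λ ()) , (λ ()) , (λ ())
cover-split f (a ∷ α) Y⊆ cov with cover-split (f ∘ fsuc) α Y⊆ (cov ∘ there)
cover-split f (false ∷ α) Y⊆ cov | β , β⊆α , cov₁ , cov₂ =
  false ∷ β , (λ { (there m) → there (β⊆α m) }) , (λ { (there m) → cov₁ m })
            , (λ { (there m) → cov₂ m })
cover-split f (true ∷ α) Y⊆ cov | β , β⊆α , cov₁ , cov₂ with Y⊆ (cov here)
... | inj₁ f0∈Y₁ =
  true ∷ β , (λ { here → here ; (there m) → there (β⊆α m) })
           , (λ { here → f0∈Y₁ ; (there m) → cov₁ m }) , (λ { (there m) → cov₂ m })
... | inj₂ f0∈Y₂ =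
  false ∷ β , (λ { (there m) → there (β⊆α m) }) , (λ { (there m) → cov₁ m })
            , (λ { here → f0∈Y₂ ; (there m) → cov₂ m })

⊨lit⇒ : ∀ b {Y p t} → Y ⊨ lit p b → t ∈ Y → t p ≡ b
⊨lit⇒ true  Y⊨ t∈Y = All.lookup Y⊨ t∈Y
⊨lit⇒ false Y⊨ t∈Y = All.lookup Y⊨ t∈Y

singleton-witness : ∀ {N} {Δ : List (LForm N)} {α φ} →
                    Any (All (_∈ Δ)) (map (λ i → (⁅ i ⁆ , φ) ∷ []) (elems α)) →
                    ∃[ i ] (i ∈ₛ α × (⁅ i ⁆ , φ) ∈ Δ)
singleton-witness {α = α} added with find (Any.map⁻ added)
... | i , i∈ , (m ∷ []) = i , ∈-elems⁻ α i∈ , m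

lit-pairs : ∀ {N} → Fin N → Fin N → List ℕ → List Bool → List (LForm N)
lit-pairs i j ps g = concat (zipWith (λ p b → (⁅ i ⁆ , lit p b) ∷ (⁅ j ⁆ , lit p b) ∷ []) ps g)

branch-extends : ∀ {L N Γ} {t : Tab L N Γ} {Δ} → Branch t Δ → ∀ {x} → x ∈ Γ → x ∈ Δ
branch-extends here        m = m
branch-extends (there _ b) m = branch-extends b (∈-++⁺ˡ m)

module Countermodel {L N} (Δ : List (LForm N)) (Δ-open : Open Δ) (sat : SaturatedBranch L Δ)
  where

  open DecMembership (LForm-≟ {N}) using (_∈?_)

  s : Fin N → Assignment
  s i p = not (does ((⁅ i ⁆ , atom p) ∈? Δ))

  s-lit : ∀ {i p} b → (⁅ i ⁆ , lit p b) ∈ Δ → s i p ≡ not b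
  s-lit {i} {p} true  m = cong not (dec-true ((⁅ i ⁆ , atom p) ∈? Δ) m)
  s-lit {i} {p} false m =
    cong not (dec-false ((⁅ i ⁆ , atom p) ∈? Δ) λ m′ → Δ-open (inj₁ (⁅ i ⁆ , p , m′ , m)))

  lit-witness : ∀ {α p} b → (α , lit p b) ∈ Δ → ∃[ i ] (i ∈ₛ α × (⁅ i ⁆ , lit p b) ∈ Δ)
  lit-witness {α} {p} true  m = singleton-witness (sat m (prop α p))
  lit-witness {α} {p} false m = singleton-witness (sat m (nprop α p))

  lits-agree : ∀ i j ps g → length g ≡ length ps → All (_∈ Δ) (lit-pairs i j ps g) →
               All (λ p → s i p ≡ s j p) ps
  lits-agree i j []       _       _   _                  = []
  lits-agree i j (p ∷ ps) []      ()  _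
  lits-agree i j (p ∷ ps) (b ∷ g) len (mi ∷ mj ∷ added) =
    trans (s-lit b mi) (sym (s-lit b mj)) ∷ lits-agree i j ps g (suc-injective len) added

  dep-pair : ∀ {α ps q} → InL L (dep ps q) → (α , dep ps q) ∈ Δ →
             ∃[ i ] ∃[ j ] (i ∈ₛ α × j ∈ₛ α × i ≢ j × (⁅ i ⁆ ∪ ⁅ j ⁆ , dep ps q) ∈ Δ)
  dep-pair {α} {ps} {q} dep m with find (Any.map⁻ (sat m (split α ps q)))
  ... | β , β∈ , (mβ ∷ []) with ∈-twoSubsets⁻ α β∈
  ... | i , j , i∈α , j∈α , refl with i ≟ j
  -- Closure condition (3) spares us proving that twoSubsets lists only genuine pairs.
  ... | yes refl = ⊥-elim (Δ-open (inj₂ (inj₂ (i , ps , q ,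
                     subst (λ γ → (γ , dep ps q) ∈ Δ) (∪-idem ⁅ i ⁆) mβ))))
  ... | no i≢j = i , j , i∈α , j∈α , i≢j , mβ

  dep-pair-violates : ∀ {i j ps q} → InL L (dep ps q) → i ≢ j →
                      (⁅ i ⁆ ∪ ⁅ j ⁆ , dep ps q) ∈ Δ →
                      All (λ p → s i p ≡ s j p) ps × s i q ≢ s j q
  dep-pair-violates {i} {j} {ps} {q} dep i≢j m
    with find (Any.map⁻ (sat m (pldep i j ps q i≢j)))
  ... | g , g∈ , added with ++⁻ (lit-pairs i j ps g) added
  ... | lits , (mq ∷ m¬q ∷ []) =
    lits-agree i j ps g (bools-length (length ps) g∈) lits , differ
    where
      differ : s i q ≢ s j q
      differ si≡sj with lit-witness true mq | lit-witness false m¬q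
      ... | k , k∈ , mk | k′ , k′∈ , mk′ = contradiction true≡false λ ()
        where
          open ≡-Reasoning
          on-pair : ∀ {l} → l ∈ₛ ⁅ i ⁆ ∪ ⁅ j ⁆ → s l q ≡ s i q
          on-pair = constant-on-pair (λ l → s l q) si≡sj
          true≡false : true ≡ false
          true≡false = begin
            true     ≡⟨ sym (s-lit false mk′) ⟩
            s k′ q   ≡⟨ on-pair k′∈ ⟩
            s i q    ≡⟨ sym (on-pair k∈) ⟩
            s k q    ≡⟨ s-lit true mk ⟩
            false    ∎

  refutes-lit : ∀ {α p Y} b → (α , lit p b) ∈ Δ → Covers s α Y → ¬ Y ⊨ lit p b
  refutes-lit b m cov Y⊨ with lit-witness b m
  ... | i , i∈α , mi = not-¬ (⊨lit⇒ b Y⊨ (cov i∈α)) (s-lit b mi)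

  refutes : ∀ {ψ α Y} → InL L ψ → (α , ψ) ∈ Δ → Covers s α Y → ¬ Y ⊨ ψ
  refutes atom m cov = refutes-lit true m cov
  refutes neg  m cov = refutes-lit false m cov
  refutes {α = α} (and {φ = φ} {ψ} Lφ Lψ) m cov (Y⊨φ , Y⊨ψ) with sat m (and α φ ψ)
  ... | here (mφ ∷ [])         = refutes Lφ mφ cov Y⊨φ
  ... | there (here (mψ ∷ [])) = refutes Lψ mψ cov Y⊨ψ
  refutes {α = α} (vor {φ} {ψ} Lφ Lψ) m cov Y⊨ with sat m (vor α φ ψ)
  ... | here (mφ ∷ mψ ∷ []) = [ refutes Lφ mφ cov , refutes Lψ mψ cov ]′ Y⊨
  refutes {α = α} (or {φ = φ} {ψ} Lφ Lψ) m cov (Y₁ , Y₂ , Y≡Y₁∪Y₂ , Y₁⊨φ , Y₂⊨ψ)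
    with cover-split s α (λ {x} → Equivalence.to (Y≡Y₁∪Y₂ x)) cov
  ... | β , β⊆α , cov₁ , cov₂ with sat m (or α φ ψ β β⊆α)
  ... | here (mφ ∷ [])         = refutes Lφ mφ cov₁ Y₁⊨φ
  ... | there (here (mψ ∷ [])) = refutes Lψ mψ cov₂ Y₂⊨ψ
  refutes dep m cov Y⊨ with dep-pair dep m
  ... | i , j , i∈α , j∈α , i≢j , mij with dep-pair-violates dep i≢j mij
  ... | agree , differ = differ (Y⊨ (s i) (s j) (cov i∈α) (cov j∈α) agree)

lemma1 : (L : Lang) (φ : Form) → InL L φ →
    (t : TableauFor L φ) → Saturated t →
    (∃[ Δ ] (Branch t Δ × Open Δ)) →
    ¬ Valid φ
lemma1 L φ φ∈L t saturated (Δ , branch , Δ-open) valid =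
  refutes φ∈L (branch-extends branch (here refl)) covers-all (valid X)
  where
    open Countermodel Δ Δ-open (saturated Δ branch)
    X : Team
    X = map s (allFin _)
    covers-all : Covers s ⊤ X
    covers-all {i} _ = ∈-map⁺ s (∈-allFin i)
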